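{- Let $m\geq 1$ be an integer and $p$ a prime with $p\nmid m$. Then $$\sum_{k=1}^{p-1}\frac{B_{k+1}}{(-m)^{k}} \equiv (-1)^{m}D_{m} \pmod{p},\qquad \sum_{k=1}^{p-1}\frac{B_{k+2}}{(-m)^{k}} \equiv (-1)^{m}(D_{m}-D_{m+1}) \pmod{p}.$$
   Context: $B_k$ denotes the $k$-th Bell number (number of set partitions of $\{1,\dots,k\}$, $B_0=1$) and $D_k$ the $k$-th derangement number (number of fixed-point-free permutations of $\{1,\dots,k\}$, $D_0=1$). The fractions $1/(-m)^k$ are interpreted modulo $p$. -}

module Defs where

open import Data.Nat as ℕ using (ℕ; zero; suc)
open import Data.Integer as ℤ using (ℤ; +_)

stirling2 : ℕ → ℕ → ℕ
stirling2 zero    zero    = 1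
stirling2 zero    (suc k) = 0
stirling2 (suc n) zero    = 0
stirling2 (suc n) (suc k) = suc k ℕ.* stirling2 n (suc k) ℕ.+ stirling2 n k

∑ℕ : ℕ → (ℕ → ℕ) → ℕ
∑ℕ zero    f = 0
∑ℕ (suc n) f = ∑ℕ n f ℕ.+ f n

bell : ℕ → ℕ
bell n = ∑ℕ (suc n) (stirling2 n)

derangement : ℕ → ℕ
derangement zero          = 1
derangement (suc zero)    = 0
derangement (suc (suc n)) = suc n ℕ.* (derangement (suc n) ℕ.+ derangement n)

∑ : ℕ → (ℕ → ℤ) → ℤ
∑ zero    f = + 0
∑ (suc n) f = ∑ n f ℤ.+ f n

-- For the Bell numbers put T_a(j) = Σ_k C(p-1,k) j^(p-1-k) B_{a+k}; umbrally T_a(j) = E[B^a (B + j)^(p-1)],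
-- and the Bell umbra satisfies B^(a+1) = (B + 1)^a. Modulo p, C(p-1,k) ≡ (-1)^(p-1-k) and u^(p-1) ≡ 1, so
-- Σ_{k<p} B_{a+k} u^k ≡ T_a(m); the umbral identity gives T_1(m) = d(m+1) and T_2(m) = d(m+2) + d(m+1) for
-- d(j) = T_0(j). By Pascal E[(B + j)^p] = d(j+1) + j d(j), and since p | C(p,k) for 0 < k < p,
-- E[(B + j)^p] ≡ j^p + B_p ≡ j + 2 by Fermat and B_p ≡ 2. So d(j+1) ≡ j + 2 - j d(j), whose solution
-- d(j+1) - 1 ≡ (-1)^j D_j is the derangement recurrence D_{j+1} = (j+1) D_j + (-1)^(j+1).
-- Finally B_p ≡ 2 because S(p,k) ≡ S(1,k) for k < p, which is read off from x^p ≡ x at x = 0, …, p-1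
-- written in the falling-factorial basis.

module Submission where

open import Defs
open import Data.Nat using (ℕ; suc; _∸_; _≥_)
open import Data.Nat.Primality using (Prime)
open import Data.Integer using (ℤ; +_; -_; _+_; _-_; _*_; _^_)
open import Data.Integer.Divisibility using (_∣_)
open import Data.Product using (_×_; _,_)
open import Relation.Nullary using (¬_)

import Data.Nat as ℕ
open import Data.Nat using (zero; z≤n; s≤s)
open import Data.Integer using (∣_∣)
open import Data.Nat.Combinatorics using (_C_; nCk+nC[k+1]≡[n+1]C[k+1]; k>n⇒nCk≡0; nCn≡1; nC1≡n)
import Data.Nat.Properties as ℕ
import Data.Integer.Properties as ℤ
import Data.Integer.Divisibility.Signed as Signed
open import Data.Integer.Tactic.RingSolver using (solve-∀)
open import Data.Nat.Tactic.RingSolver using () renaming (solve-∀ to ℕ-solve-∀)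
open import Function using (_∘_)
open import Data.Sum using (_⊎_; inj₁; inj₂)
open import Relation.Binary.Bundles using (Setoid)
import Relation.Binary.Reasoning.Setoid as SetoidReasoning
import Data.Nat.Divisibility as ℕD
import Data.Integer.DivMod as ℤDM
open import Data.Nat.Primality using (euclidsLemma; prime⇒nonTrivial)
open import Data.Empty using (⊥-elim)
open import Data.Nat.Induction using (<-rec)
open import Relation.Binary.Definitions using (tri<; tri≈; tri>)
open import Relation.Binary.Structures using (IsEquivalence)
open import Relation.Binary.PropositionalEquality

∑-cong< : ∀ N {f g : ℕ → ℤ} → (∀ k → k ℕ.< N → f k ≡ g k) → ∑ N f ≡ ∑ N g
∑-cong< zero    f≡g = refl
∑-cong< (suc N) f≡g = cong₂ _+_ (∑-cong< N (λ k k<N → f≡g k (ℕ.m<n⇒m<1+n k<N))) (f≡g N ℕ.≤-refl)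

∑-cong : ∀ N {f g : ℕ → ℤ} → (∀ k → f k ≡ g k) → ∑ N f ≡ ∑ N g
∑-cong N f≡g = ∑-cong< N (λ k _ → f≡g k)

∑-0 : ∀ N → ∑ N (λ _ → + 0) ≡ + 0
∑-0 zero    = refl
∑-0 (suc N) = cong (_+ + 0) (∑-0 N)

∑-distrib-+ : ∀ N (f g : ℕ → ℤ) → ∑ N (λ k → f k + g k) ≡ ∑ N f + ∑ N g
∑-distrib-+ zero    f g = refl
∑-distrib-+ (suc N) f g = trans (cong (_+ (f N + g N)) (∑-distrib-+ N f g)) (interchange (∑ N f) (∑ N g) (f N) (g N))
  where interchange : ∀ a b c d → (a + b) + (c + d) ≡ (a + c) + (b + d)
        interchange = solve-∀

*-distribˡ-∑ : ∀ N c (f : ℕ → ℤ) → ∑ N (λ k → c * f k) ≡ c * ∑ N f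
*-distribˡ-∑ zero    c f = sym (ℤ.*-zeroʳ c)
*-distribˡ-∑ (suc N) c f = trans (cong (_+ c * f N) (*-distribˡ-∑ N c f)) (sym (ℤ.*-distribˡ-+ c (∑ N f) (f N)))

∑-head : ∀ N (f : ℕ → ℤ) → ∑ (suc N) f ≡ f 0 + ∑ N (f ∘ suc)
∑-head zero    f = trans (ℤ.+-identityˡ (f 0)) (sym (ℤ.+-identityʳ (f 0)))
∑-head (suc N) f = trans (cong (_+ f (suc N)) (∑-head N f)) (ℤ.+-assoc (f 0) _ _)

∑-comm : ∀ N M (f : ℕ → ℕ → ℤ) → ∑ N (λ i → ∑ M (f i)) ≡ ∑ M (λ k → ∑ N (λ i → f i k))
∑-comm zero    M f = sym (∑-0 M)
∑-comm (suc N) M f =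
  trans (cong (_+ ∑ M (f N)) (∑-comm N M f)) (sym (∑-distrib-+ M (λ k → ∑ N (λ i → f i k)) (f N)))

∑-pad : ∀ {M N} (f : ℕ → ℤ) → M ℕ.≤ N → (∀ k → M ℕ.≤ k → f k ≡ + 0) → ∑ N f ≡ ∑ M f
∑-pad {N = zero}  f z≤n  vanish = refl
∑-pad {N = suc N} f M≤1+N vanish with ℕ.m≤n⇒m<n∨m≡n M≤1+N
... | inj₂ refl        = refl
... | inj₁ (s≤s M≤N) = trans (cong₂ _+_ (∑-pad f M≤N vanish) (vanish N M≤N)) (ℤ.+-identityʳ _)

∑ℕ-as-∑ : ∀ N (f : ℕ → ℕ) → + ∑ℕ N f ≡ ∑ N (+_ ∘ f)
∑ℕ-as-∑ zero    f = refl
∑ℕ-as-∑ (suc N) f = trans (ℤ.pos-+ (∑ℕ N f) (f N)) (cong (_+ + f N) (∑ℕ-as-∑ N f))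

module Modulo (n : ℤ) where

  infix 4 _≈_
  record _≈_ (a b : ℤ) : Set where
    constructor ∣⇒≈
    field ≈⇒∣ : n Signed.∣ a - b
  open _≈_ public

  private
    ∣-resp : ∀ {x y} → x ≡ y → n Signed.∣ x → n Signed.∣ y
    ∣-resp = subst (n Signed.∣_)

  ≈-isEquivalence : IsEquivalence _≈_
  ≈-isEquivalence = record
    { refl  = λ {a} → ∣⇒≈ (∣-resp (sym (ℤ.+-inverseʳ a)) (Signed.divides (+ 0) (sym (ℤ.*-zeroˡ n))))
    ; sym   = λ {a} {b} a≈b → ∣⇒≈ (∣-resp (negate a b) (Signed.∣m⇒∣-m (≈⇒∣ a≈b)))
    ; trans = λ {a} {b} {c} a≈b b≈c → ∣⇒≈ (∣-resp (chain a b c) (Signed.∣m∣n⇒∣m+n (≈⇒∣ a≈b) (≈⇒∣ b≈c)))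
    }
    where
    negate : ∀ a b → - (a - b) ≡ b - a
    negate = solve-∀
    chain : ∀ a b c → (a - b) + (b - c) ≡ a - c
    chain = solve-∀

  ≈-setoid : Setoid _ _
  ≈-setoid = record { isEquivalence = ≈-isEquivalence }

  open IsEquivalence ≈-isEquivalence public
    using () renaming (refl to ≈-refl; sym to ≈-sym; trans to ≈-trans; reflexive to ≈-reflexive)

  ∣⇒≈0 : ∀ {a} → n Signed.∣ a → a ≈ + 0
  ∣⇒≈0 {a} n∣a = ∣⇒≈ (∣-resp (sym (ℤ.+-identityʳ a)) n∣a)

  ≈0⇒∣ : ∀ {a} → a ≈ + 0 → n Signed.∣ a
  ≈0⇒∣ {a} a≈0 = ∣-resp (ℤ.+-identityʳ a) (≈⇒∣ a≈0)

  +-cong : ∀ {a b c d} → a ≈ b → c ≈ d → a + c ≈ b + d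
  +-cong {a} {b} {c} {d} a≈b c≈d = ∣⇒≈ (∣-resp (rearrange a b c d) (Signed.∣m∣n⇒∣m+n (≈⇒∣ a≈b) (≈⇒∣ c≈d)))
    where rearrange : ∀ a b c d → (a - b) + (c - d) ≡ (a + c) - (b + d)
          rearrange = solve-∀

  -‿cong : ∀ {a b} → a ≈ b → - a ≈ - b
  -‿cong {a} {b} a≈b = ∣⇒≈ (∣-resp (rearrange a b) (Signed.∣m⇒∣-m (≈⇒∣ a≈b)))
    where rearrange : ∀ a b → - (a - b) ≡ - a - - b
          rearrange = solve-∀

  x≈b+s⇒s≈x-b : ∀ {x b s} → x ≈ b + s → s ≈ x - b
  x≈b+s⇒s≈x-b {x} {b} {s} x≈b+s = ≈-trans (≈-reflexive (add-sub s b)) (+-cong (≈-sym x≈b+s) ≈-refl)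
    where add-sub : ∀ s b → s ≡ (b + s) - b
          add-sub = solve-∀

  *-cong : ∀ {a b c d} → a ≈ b → c ≈ d → a * c ≈ b * d
  *-cong {a} {b} {c} {d} a≈b c≈d =
    ∣⇒≈ (∣-resp (rearrange a b c d)
              (Signed.∣m∣n⇒∣m+n (Signed.∣m⇒∣m*n c (≈⇒∣ a≈b)) (Signed.∣n⇒∣m*n b (≈⇒∣ c≈d))))
    where rearrange : ∀ a b c d → (a - b) * c + b * (c - d) ≡ a * c - b * d
          rearrange = solve-∀

  ^-congˡ : ∀ {a b} k → a ≈ b → a ^ k ≈ b ^ k
  ^-congˡ zero    a≈b = ≈-refl
  ^-congˡ (suc k) a≈b = *-cong a≈b (^-congˡ k a≈b)

  ≈0⇒*≈0 : ∀ {a} b → a ≈ + 0 → a * b ≈ + 0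
  ≈0⇒*≈0 b a≈0 = ≈-trans (*-cong a≈0 ≈-refl) (≈-reflexive (ℤ.*-zeroˡ b))

  ∑-cong-≈ : ∀ N {f g : ℕ → ℤ} → (∀ k → k ℕ.< N → f k ≈ g k) → ∑ N f ≈ ∑ N g
  ∑-cong-≈ zero    f≈g = ≈-refl
  ∑-cong-≈ (suc N) f≈g = +-cong (∑-cong-≈ N (λ k k<N → f≈g k (ℕ.m<n⇒m<1+n k<N))) (f≈g N ℕ.≤-refl)

  ∑-single : ∀ N (f : ℕ → ℤ) {x} → x ℕ.< N → (∀ k → k ℕ.< N → k ≢ x → f k ≈ + 0) → ∑ N f ≈ f x
  ∑-single (suc N) f {x} x<1+N others with ℕ.m≤n⇒m<n∨m≡n (ℕ.≤-pred x<1+N)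
  ... | inj₁ x<N =
    ≈-trans (+-cong (∑-single N f x<N (λ k k<N → others k (ℕ.m<n⇒m<1+n k<N)))
                    (others N ℕ.≤-refl (λ N≡x → ℕ.<-irrefl (sym N≡x) x<N)))
            (≈-reflexive (ℤ.+-identityʳ (f x)))
  ... | inj₂ refl =
    ≈-trans (+-cong (≈-trans (∑-cong-≈ N (λ k k<N → others k (ℕ.m<n⇒m<1+n k<N) (λ k≡N → ℕ.<-irrefl k≡N k<N)))
                             (≈-reflexive (∑-0 N)))
                    ≈-refl)
            (≈-reflexive (ℤ.+-identityˡ (f x)))

[k+1]*[n+1]C[k+1]≡[n+1]*nCk : ∀ n k → suc k ℕ.* (suc n C suc k) ≡ suc n ℕ.* (n C k)
[k+1]*[n+1]C[k+1]≡[n+1]*nCk zero    zero    = refl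
[k+1]*[n+1]C[k+1]≡[n+1]*nCk zero    (suc k) = ℕ.*-zeroʳ (suc (suc k))
[k+1]*[n+1]C[k+1]≡[n+1]*nCk (suc n) zero    = trans (ℕ.*-identityˡ _) (trans (nC1≡n (suc (suc n))) (sym (ℕ.*-identityʳ _)))
[k+1]*[n+1]C[k+1]≡[n+1]*nCk (suc n) (suc k) = begin
    suc (suc k) ℕ.* (suc (suc n) C suc (suc k))
  ≡⟨ cong (suc (suc k) ℕ.*_) (sym (nCk+nC[k+1]≡[n+1]C[k+1] (suc n) (suc k))) ⟩
    suc (suc k) ℕ.* (suc n C suc k ℕ.+ suc n C suc (suc k))
  ≡⟨ expand (suc k) (suc n C suc k) (suc n C suc (suc k)) ⟩
    suc n C suc k ℕ.+ suc k ℕ.* (suc n C suc k) ℕ.+ suc (suc k) ℕ.* (suc n C suc (suc k))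
  ≡⟨ cong₂ (λ x y → suc n C suc k ℕ.+ x ℕ.+ y)
           ([k+1]*[n+1]C[k+1]≡[n+1]*nCk n k) ([k+1]*[n+1]C[k+1]≡[n+1]*nCk n (suc k)) ⟩
    suc n C suc k ℕ.+ suc n ℕ.* (n C k) ℕ.+ suc n ℕ.* (n C suc k)
  ≡⟨ cong (λ c → c ℕ.+ suc n ℕ.* (n C k) ℕ.+ suc n ℕ.* (n C suc k)) (sym (nCk+nC[k+1]≡[n+1]C[k+1] n k)) ⟩
    (n C k ℕ.+ n C suc k) ℕ.+ suc n ℕ.* (n C k) ℕ.+ suc n ℕ.* (n C suc k)
  ≡⟨ collect (suc n) (n C k) (n C suc k) ⟩
    suc (suc n) ℕ.* (n C k ℕ.+ n C suc k)
  ≡⟨ cong (suc (suc n) ℕ.*_) (nCk+nC[k+1]≡[n+1]C[k+1] n k) ⟩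
    suc (suc n) ℕ.* (suc n C suc k)
  ∎
  where open ≡-Reasoning
        expand : ∀ a x y → (1 ℕ.+ a) ℕ.* (x ℕ.+ y) ≡ x ℕ.+ a ℕ.* x ℕ.+ (1 ℕ.+ a) ℕ.* y
        expand = ℕ-solve-∀
        collect : ∀ a x y → (x ℕ.+ y) ℕ.+ a ℕ.* x ℕ.+ a ℕ.* y ≡ (1 ℕ.+ a) ℕ.* (x ℕ.+ y)
        collect = ℕ-solve-∀

-- Reading s k as the k-th moment E[X^k], binomialTransform s j n is E[(X + j)^n].
binomialTransform : (ℕ → ℤ) → ℤ → ℕ → ℤ
binomialTransform s j n = ∑ (suc n) (λ k → + (n C k) * (j ^ (n ∸ k) * s k))

binomialTransform-zero : ∀ s j → binomialTransform s j 0 ≡ s 0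
binomialTransform-zero s j = simplify (s 0)
  where simplify : ∀ x → + 0 + (+ 1 * (+ 1 * x)) ≡ x
        simplify = solve-∀

binomialTransform-cong : ∀ {s t} j n → (∀ k → s k ≡ t k) → binomialTransform s j n ≡ binomialTransform t j n
binomialTransform-cong j n s≡t = ∑-cong (suc n) (λ k → cong (λ x → + (n C k) * (j ^ (n ∸ k) * x)) (s≡t k))

binomialTransform-+ : ∀ s t j n →
  binomialTransform (λ k → s k + t k) j n ≡ binomialTransform s j n + binomialTransform t j n
binomialTransform-+ s t j n =
  trans (∑-cong (suc n) (λ k → distrib (+ (n C k)) (j ^ (n ∸ k)) (s k) (t k))) (∑-distrib-+ (suc n) _ _)
  where distrib : ∀ a b x y → a * (b * (x + y)) ≡ a * (b * x) + a * (b * y)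
        distrib = solve-∀

binomialTransform-* : ∀ c s j n → binomialTransform (λ k → c * s k) j n ≡ c * binomialTransform s j n
binomialTransform-* c s j n =
  trans (∑-cong (suc n) (λ k → pull c (+ (n C k)) (j ^ (n ∸ k)) (s k))) (*-distribˡ-∑ (suc n) c _)
  where pull : ∀ c a b x → a * (b * (c * x)) ≡ c * (a * (b * x))
        pull = solve-∀

binomialTransform-suc : ∀ s j n →
  binomialTransform s j (suc n) ≡ binomialTransform (s ∘ suc) j n + j * binomialTransform s j n
binomialTransform-suc s j n = begin
    ∑ (suc (suc n)) g
  ≡⟨ ∑-head (suc n) g ⟩
    g 0 + ∑ (suc n) (g ∘ suc)
  ≡⟨ cong (λ x → g 0 + x) (trans (∑-cong (suc n) pascal) (∑-distrib-+ (suc n) A R)) ⟩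
    g 0 + (∑ (suc n) A + ∑ (suc n) R)
  ≡⟨ cong₂ (λ x y → x + (∑ (suc n) A + y)) g0≡j*h0 ∑R≡∑j*h∘suc ⟩
    j * h 0 + (∑ (suc n) A + ∑ n (λ k → j * h (suc k)))
  ≡⟨ rearrange (j * h 0) (∑ (suc n) A) _ ⟩
    ∑ (suc n) A + (j * h 0 + ∑ n (λ k → j * h (suc k)))
  ≡⟨ cong (λ x → ∑ (suc n) A + x) (trans (sym (∑-head n (λ k → j * h k))) (*-distribˡ-∑ (suc n) j h)) ⟩
    ∑ (suc n) A + j * ∑ (suc n) h
  ∎
  where
  open ≡-Reasoning
  g h A R : ℕ → ℤ
  g k = + (suc n C k) * (j ^ (suc n ∸ k) * s k)
  h k = + (n C k) * (j ^ (n ∸ k) * s k)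
  A k = + (n C k) * (j ^ (n ∸ k) * s (suc k))
  R k = + (n C suc k) * (j ^ (n ∸ k) * s (suc k))
  pascal : ∀ k → g (suc k) ≡ A k + R k
  pascal k = trans (cong (λ c → + c * (j ^ (n ∸ k) * s (suc k))) (sym (nCk+nC[k+1]≡[n+1]C[k+1] n k)))
                   (trans (cong (_* (j ^ (n ∸ k) * s (suc k))) (ℤ.pos-+ (n C k) (n C suc k)))
                          (ℤ.*-distribʳ-+ _ (+ (n C k)) (+ (n C suc k))))
  g0≡j*h0 : g 0 ≡ j * h 0
  g0≡j*h0 = reassoc j (j ^ n) (s 0)
    where reassoc : ∀ j jn x → + 1 * ((j * jn) * x) ≡ j * (+ 1 * (jn * x))
          reassoc = solve-∀
  R≡j*h∘suc : ∀ k → k ℕ.< n → R k ≡ j * h (suc k)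
  R≡j*h∘suc k k<n rewrite ℕ.+-∸-assoc 1 k<n = reassoc (+ (n C suc k)) j (j ^ (n ∸ suc k)) (s (suc k))
    where reassoc : ∀ c j b x → c * ((j * b) * x) ≡ j * (c * (b * x))
          reassoc = solve-∀
  Rn≡0 : R n ≡ + 0
  Rn≡0 = trans (cong (λ c → + c * (j ^ (n ∸ n) * s (suc n))) (k>n⇒nCk≡0 (ℕ.n<1+n n)))
               (ℤ.*-zeroˡ (j ^ (n ∸ n) * s (suc n)))
  ∑R≡∑j*h∘suc : ∑ (suc n) R ≡ ∑ n (λ k → j * h (suc k))
  ∑R≡∑j*h∘suc = trans (cong₂ _+_ (∑-cong< n R≡j*h∘suc) Rn≡0) (ℤ.+-identityʳ _)
  rearrange : ∀ a b c → a + (b + c) ≡ b + (a + c)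
  rearrange = solve-∀

binomial-theorem : ∀ a j n → binomialTransform (a ^_) j n ≡ (a + j) ^ n
binomial-theorem a j zero    = binomialTransform-zero (a ^_) j
binomial-theorem a j (suc n) = begin
    binomialTransform (a ^_) j (suc n)
  ≡⟨ binomialTransform-suc (a ^_) j n ⟩
    binomialTransform (λ k → a * a ^ k) j n + j * binomialTransform (a ^_) j n
  ≡⟨ cong (_+ j * binomialTransform (a ^_) j n) (binomialTransform-* a (a ^_) j n) ⟩
    a * binomialTransform (a ^_) j n + j * binomialTransform (a ^_) j n
  ≡⟨ sym (ℤ.*-distribʳ-+ _ a j) ⟩
    (a + j) * binomialTransform (a ^_) j n
  ≡⟨ cong ((a + j) *_) (binomial-theorem a j n) ⟩
    (a + j) ^ suc n
  ∎
  where open ≡-Reasoning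

stirling2-above : ∀ {n k} → n ℕ.< k → stirling2 n k ≡ 0
stirling2-above {zero}  {suc k} _ = refl
stirling2-above {suc n} {suc k} (s≤s n<k)
  rewrite stirling2-above (ℕ.m<n⇒m<1+n n<k) | stirling2-above n<k = trans (ℕ.+-identityʳ (suc k ℕ.* 0)) (ℕ.*-zeroʳ (suc k))

stirling2-diagonal : ∀ n → stirling2 n n ≡ 1
stirling2-diagonal zero    = refl
stirling2-diagonal (suc n)
  rewrite stirling2-above (ℕ.n<1+n n) | stirling2-diagonal n = trans (ℕ.+-comm (n ℕ.* 0) 1) (cong suc (ℕ.*-zeroʳ n))

stirling2-suc : ∀ i k → + stirling2 (suc i) (suc k) ≡ + suc k * + stirling2 i (suc k) + + stirling2 i k
stirling2-suc i k = trans (ℤ.pos-+ (suc k ℕ.* stirling2 i (suc k)) (stirling2 i k))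
                          (cong (_+ + stirling2 i k) (ℤ.pos-* (suc k) (stirling2 i (suc k))))

binomialTransform-stirling2 : ∀ n k →
  binomialTransform (λ i → + stirling2 i k) (+ 1) n ≡ + stirling2 (suc n) (suc k)
binomialTransform-stirling2 zero    k =
  trans (binomialTransform-zero (λ i → + stirling2 i k) (+ 1))
        (cong (λ x → + (x ℕ.+ stirling2 0 k)) (sym (ℕ.*-zeroʳ (suc k))))
binomialTransform-stirling2 (suc n) zero = begin
    binomialTransform (λ i → + stirling2 i 0) (+ 1) (suc n)
  ≡⟨ binomialTransform-suc _ (+ 1) n ⟩
    binomialTransform (λ _ → + 0 * + 0) (+ 1) n + + 1 * binomialTransform (λ i → + stirling2 i 0) (+ 1) n
  ≡⟨ cong₂ (λ x y → x + + 1 * y) (binomialTransform-* (+ 0) (λ _ → + 0) (+ 1) n) (binomialTransform-stirling2 n 0) ⟩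
    + 0 + + 1 * + stirling2 (suc n) 1
  ≡⟨ simplify (+ stirling2 (suc n) 1) ⟩
    + stirling2 (suc n) 1
  ≡⟨ cong +_ (sym (trans (ℕ.+-identityʳ _) (ℕ.*-identityˡ _))) ⟩
    + stirling2 (suc (suc n)) 1
  ∎
  where open ≡-Reasoning
        simplify : ∀ x → + 0 + + 1 * x ≡ x
        simplify = solve-∀
binomialTransform-stirling2 (suc n) (suc k) = begin
    T (suc k) (suc n)
  ≡⟨ binomialTransform-suc _ (+ 1) n ⟩
    binomialTransform (λ i → + stirling2 (suc i) (suc k)) (+ 1) n + + 1 * T (suc k) n
  ≡⟨ cong (_+ + 1 * T (suc k) n) (trans (binomialTransform-cong (+ 1) n (λ i → stirling2-suc i k))
       (trans (binomialTransform-+ _ _ (+ 1) n) (cong (_+ T k n) (binomialTransform-* (+ suc k) _ (+ 1) n)))) ⟩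
    (+ suc k * T (suc k) n + T k n) + + 1 * T (suc k) n
  ≡⟨ cong₂ (λ x y → (+ suc k * x + y) + + 1 * x) (binomialTransform-stirling2 n (suc k)) (binomialTransform-stirling2 n k) ⟩
    (+ suc k * + stirling2 (suc n) (suc (suc k)) + + stirling2 (suc n) (suc k)) + + 1 * + stirling2 (suc n) (suc (suc k))
  ≡⟨ collect (+ suc k) (+ stirling2 (suc n) (suc (suc k))) (+ stirling2 (suc n) (suc k)) ⟩
    (+ 1 + + suc k) * + stirling2 (suc n) (suc (suc k)) + + stirling2 (suc n) (suc k)
  ≡⟨ sym (stirling2-suc (suc n) (suc k)) ⟩
    + stirling2 (suc (suc n)) (suc (suc k))
  ∎
  where open ≡-Reasoning
        T : ℕ → ℕ → ℤ
        T k = binomialTransform (λ i → + stirling2 i k) (+ 1)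
        collect : ∀ c a b → (c * a + b) + + 1 * a ≡ (+ 1 + c) * a + b
        collect = solve-∀

bell≡∑stirling2 : ∀ {i N} → i ℕ.< N → ∑ N (λ k → + stirling2 i k) ≡ + bell i
bell≡∑stirling2 {i} i<N =
  trans (∑-pad _ i<N (λ k i<k → cong +_ (stirling2-above i<k))) (sym (∑ℕ-as-∑ (suc i) (stirling2 i)))

bell-suc : ∀ n → + bell (suc n) ≡ binomialTransform (λ i → + bell i) (+ 1) n
bell-suc n = begin
    + bell (suc n)
  ≡⟨ trans (∑ℕ-as-∑ (suc (suc n)) (stirling2 (suc n))) (∑-head (suc n) _) ⟩
    + 0 + ∑ (suc n) (λ k → + stirling2 (suc n) (suc k))
  ≡⟨ trans (ℤ.+-identityˡ _) (∑-cong (suc n) (λ k → sym (binomialTransform-stirling2 n k))) ⟩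
    ∑ (suc n) (λ k → ∑ (suc n) (λ i → c i * ((+ 1) ^ (n ∸ i) * + stirling2 i k)))
  ≡⟨ ∑-comm (suc n) (suc n) (λ k i → c i * ((+ 1) ^ (n ∸ i) * + stirling2 i k)) ⟩
    ∑ (suc n) (λ i → ∑ (suc n) (λ k → c i * ((+ 1) ^ (n ∸ i) * + stirling2 i k)))
  ≡⟨ ∑-cong< (suc n) (λ i i<1+n → trans (*-distribˡ-∑ (suc n) (c i) _)
       (cong (c i *_) (trans (*-distribˡ-∑ (suc n) ((+ 1) ^ (n ∸ i)) _) (cong ((+ 1) ^ (n ∸ i) *_) (bell≡∑stirling2 i<1+n))))) ⟩
    binomialTransform (λ i → + bell i) (+ 1) n
  ∎
  where open ≡-Reasoning
        c : ℕ → ℤ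
        c i = + (n C i)

+j+1≡+[1+j] : ∀ j → + j + + 1 ≡ + suc j
+j+1≡+[1+j] j = trans (sym (ℤ.pos-+ j 1)) (cong +_ (ℕ.+-comm j 1))

bellTransform : ℕ → ℤ → ℕ → ℤ
bellTransform a = binomialTransform (λ k → + bell (a ℕ.+ k))

bellTransform-zero : ∀ a j → bellTransform a j 0 ≡ + bell a
bellTransform-zero a j = trans (binomialTransform-zero (λ k → + bell (a ℕ.+ k)) j) (cong (λ i → + bell i) (ℕ.+-identityʳ a))

bellTransform-suc : ∀ a j n → bellTransform a j (suc n) ≡ bellTransform (suc a) j n + j * bellTransform a j n
bellTransform-suc a j n = trans (binomialTransform-suc _ j n)
  (cong (_+ j * bellTransform a j n) (binomialTransform-cong j n (λ k → cong (λ i → + bell i) (ℕ.+-suc a k))))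

-- Umbrally, with Bell moments B^(a+1) = (B + 1)^a: E[B^(a+1) (B + j)^n] = E[(B + 1)^a (B + j + 1)^n].
bellTransform-shift : ∀ j n a → bellTransform (suc a) j n ≡ binomialTransform (λ i → bellTransform i (j + + 1) n) (+ 1) a
bellTransform-shift j zero a = begin
    bellTransform (suc a) j 0
  ≡⟨ bellTransform-zero (suc a) j ⟩
    + bell (suc a)
  ≡⟨ bell-suc a ⟩
    binomialTransform (λ i → + bell i) (+ 1) a
  ≡⟨ binomialTransform-cong (+ 1) a (λ i → sym (bellTransform-zero i (j + + 1))) ⟩
    binomialTransform (λ i → bellTransform i (j + + 1) 0) (+ 1) a
  ∎
  where open ≡-Reasoning
bellTransform-shift j (suc n) a = begin
    bellTransform (suc a) j (suc n)
  ≡⟨ bellTransform-suc (suc a) j n ⟩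
    bellTransform (suc (suc a)) j n + j * bellTransform (suc a) j n
  ≡⟨ cong₂ (λ x y → x + j * y) (bellTransform-shift j n (suc a)) (bellTransform-shift j n a) ⟩
    binomialTransform F (+ 1) (suc a) + j * binomialTransform F (+ 1) a
  ≡⟨ cong (_+ j * binomialTransform F (+ 1) a) (binomialTransform-suc F (+ 1) a) ⟩
    (binomialTransform (F ∘ suc) (+ 1) a + + 1 * binomialTransform F (+ 1) a) + j * binomialTransform F (+ 1) a
  ≡⟨ collect (binomialTransform (F ∘ suc) (+ 1) a) (binomialTransform F (+ 1) a) j ⟩
    binomialTransform (F ∘ suc) (+ 1) a + (j + + 1) * binomialTransform F (+ 1) a
  ≡⟨ sym (trans (binomialTransform-+ _ _ (+ 1) a)
                (cong (λ x → binomialTransform (F ∘ suc) (+ 1) a + x) (binomialTransform-* (j + + 1) F (+ 1) a))) ⟩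
    binomialTransform (λ i → F (suc i) + (j + + 1) * F i) (+ 1) a
  ≡⟨ sym (binomialTransform-cong (+ 1) a (λ i → bellTransform-suc i (j + + 1) n)) ⟩
    binomialTransform (λ i → bellTransform i (j + + 1) (suc n)) (+ 1) a
  ∎
  where open ≡-Reasoning
        F : ℕ → ℤ
        F i = bellTransform i (j + + 1) n
        collect : ∀ x y j → (x + + 1 * y) + j * y ≡ x + (j + + 1) * y
        collect = solve-∀

bellTransform-1 : ∀ j n → bellTransform 1 (+ j) n ≡ bellTransform 0 (+ suc j) n
bellTransform-1 j n = begin
    bellTransform 1 (+ j) n
  ≡⟨ bellTransform-shift (+ j) n 0 ⟩
    binomialTransform (λ i → bellTransform i (+ j + + 1) n) (+ 1) 0
  ≡⟨ binomialTransform-zero (λ i → bellTransform i (+ j + + 1) n) (+ 1) ⟩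
    bellTransform 0 (+ j + + 1) n
  ≡⟨ cong (λ i → bellTransform 0 i n) (+j+1≡+[1+j] j) ⟩
    bellTransform 0 (+ suc j) n
  ∎
  where open ≡-Reasoning

bellTransform-2 : ∀ j n → bellTransform 2 (+ j) n ≡ bellTransform 0 (+ suc (suc j)) n + bellTransform 0 (+ suc j) n
bellTransform-2 j n = begin
    bellTransform 2 (+ j) n
  ≡⟨ bellTransform-shift (+ j) n 1 ⟩
    binomialTransform F (+ 1) 1
  ≡⟨ binomialTransform-suc F (+ 1) 0 ⟩
    binomialTransform (F ∘ suc) (+ 1) 0 + + 1 * binomialTransform F (+ 1) 0
  ≡⟨ cong₂ (λ x y → x + + 1 * y) (binomialTransform-zero (F ∘ suc) (+ 1)) (binomialTransform-zero F (+ 1)) ⟩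
    F 1 + + 1 * F 0
  ≡⟨ cong₂ _+_ (trans (cong (λ i → bellTransform 1 i n) (+j+1≡+[1+j] j)) (bellTransform-1 (suc j) n))
               (trans (ℤ.*-identityˡ (F 0)) (cong (λ i → bellTransform 0 i n) (+j+1≡+[1+j] j))) ⟩
    bellTransform 0 (+ suc (suc j)) n + bellTransform 0 (+ suc j) n
  ∎
  where open ≡-Reasoning
        F : ℕ → ℤ
        F i = bellTransform i (+ j + + 1) n

fallingFactorial : ℤ → ℕ → ℤ
fallingFactorial x zero    = + 1
fallingFactorial x (suc k) = fallingFactorial x k * (x - + k)

fallingFactorial-above : ∀ {x k} → x ℕ.< k → fallingFactorial (+ x) k ≡ + 0
fallingFactorial-above {x} {suc k} (s≤s x≤k) with ℕ.m≤n⇒m<n∨m≡n x≤k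
... | inj₁ x<k  rewrite fallingFactorial-above x<k = ℤ.*-zeroˡ (+ x - + k)
... | inj₂ refl rewrite ℤ.+-inverseʳ (+ x)      = ℤ.*-zeroʳ (fallingFactorial (+ x) x)

∑-stirling2-fallingFactorial : ∀ x n → ∑ (suc n) (λ k → + stirling2 n k * fallingFactorial x k) ≡ x ^ n
∑-stirling2-fallingFactorial x zero    = refl
∑-stirling2-fallingFactorial x (suc n) = begin
    ∑ (suc (suc n)) (λ k → + stirling2 (suc n) k * ff k)
  ≡⟨ trans (∑-head (suc n) _) (ℤ.+-identityˡ _) ⟩
    ∑ (suc n) (λ k → + stirling2 (suc n) (suc k) * ff (suc k))
  ≡⟨ trans (∑-cong (suc n) recurrence) (∑-distrib-+ (suc n) A B) ⟩
    ∑ (suc n) A + ∑ (suc n) B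
  ≡⟨ cong (λ a → a + ∑ (suc n) B) ∑A≡∑K ⟩
    ∑ (suc n) K + ∑ (suc n) B
  ≡⟨ trans (sym (∑-distrib-+ (suc n) K B)) (∑-cong (suc n) K+B≡x*S*ff) ⟩
    ∑ (suc n) (λ k → x * (+ stirling2 n k * ff k))
  ≡⟨ trans (*-distribˡ-∑ (suc n) x _) (cong (x *_) (∑-stirling2-fallingFactorial x n)) ⟩
    x ^ suc n
  ∎
  where
  open ≡-Reasoning
  ff A B K : ℕ → ℤ
  ff = fallingFactorial x
  A k = + suc k * (+ stirling2 n (suc k) * ff (suc k))
  B k = + stirling2 n k * ff (suc k)
  K k = + k * (+ stirling2 n k * ff k)
  recurrence : ∀ k → + stirling2 (suc n) (suc k) * ff (suc k) ≡ A k + B k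
  recurrence k = trans (cong (_* ff (suc k)) (stirling2-suc n k))
    (trans (ℤ.*-distribʳ-+ (ff (suc k)) (+ suc k * + stirling2 n (suc k)) (+ stirling2 n k))
      (cong (_+ B k) (ℤ.*-assoc (+ suc k) (+ stirling2 n (suc k)) (ff (suc k)))))
  An≡0 : A n ≡ + 0
  An≡0 rewrite stirling2-above (ℕ.n<1+n n) = trans (cong (+ suc n *_) (ℤ.*-zeroˡ (ff (suc n)))) (ℤ.*-zeroʳ (+ suc n))
  ∑A≡∑K : ∑ (suc n) A ≡ ∑ (suc n) K
  ∑A≡∑K = trans (cong (λ a → ∑ n A + a) An≡0)
                (trans (ℤ.+-identityʳ _) (sym (trans (∑-head n K) (ℤ.+-identityˡ (∑ n A)))))
  K+B≡x*S*ff : ∀ k → K k + B k ≡ x * (+ stirling2 n k * ff k)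
  K+B≡x*S*ff k = expand x (+ k) (+ stirling2 n k) (ff k)
    where expand : ∀ x k s f → k * (s * f) + s * (f * (x - k)) ≡ x * (s * f)
          expand = solve-∀

^-distribʳ-* : ∀ a b n → (a * b) ^ n ≡ a ^ n * b ^ n
^-distribʳ-* a b zero    = refl
^-distribʳ-* a b (suc n) = trans (cong ((a * b) *_) (^-distribʳ-* a b n)) (interchange a b (a ^ n) (b ^ n))
  where interchange : ∀ a b x y → (a * b) * (x * y) ≡ (a * x) * (b * y)
        interchange = solve-∀

[-1]^n*[-1]^n≡1 : ∀ n → (- + 1) ^ n * (- + 1) ^ n ≡ + 1
[-1]^n*[-1]^n≡1 n = trans (sym (^-distribʳ-* (- + 1) (- + 1) n)) (ℤ.^-zeroˡ n)

derangement-suc : ∀ j → + derangement (suc j) ≡ + suc j * + derangement j + (- + 1) ^ suc j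
derangement-suc zero    = refl
derangement-suc (suc j) = begin
    + (suc j ℕ.* (derangement (suc j) ℕ.+ derangement j))
  ≡⟨ trans (ℤ.pos-* (suc j) _) (cong (+ suc j *_) (ℤ.pos-+ (derangement (suc j)) (derangement j))) ⟩
    + suc j * (+ derangement (suc j) + + derangement j)
  ≡⟨ cong (λ D → + suc j * (D + + derangement j)) (derangement-suc j) ⟩
    + suc j * ((+ suc j * + derangement j + (- + 1) ^ suc j) + + derangement j)
  ≡⟨ collect (+ suc j) (+ derangement j) ((- + 1) ^ suc j) ⟩
    (+ 1 + + suc j) * (+ suc j * + derangement j + (- + 1) ^ suc j) + (- + 1) * (- + 1) ^ suc j
  ≡⟨ cong (λ D → (+ 1 + + suc j) * D + (- + 1) ^ suc (suc j)) (sym (derangement-suc j)) ⟩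
    (+ 1 + + suc j) * + derangement (suc j) + (- + 1) ^ suc (suc j)
  ∎
  where open ≡-Reasoning
        collect : ∀ n D s → n * ((n * D + s) + D) ≡ (+ 1 + n) * (n * D + s) + (- + 1) * s
        collect = solve-∀

module AtPrime {q : ℕ} (p-prime : Prime (suc q)) where

  p : ℕ
  p = suc q

  open Modulo (+ p) public

  private
    module ≈-Reasoning = SetoidReasoning ≈-setoid

  p∤ : ∀ {n} → 0 ℕ.< n → n ℕ.< p → ¬ (p ℕD.∣ n)
  p∤ 0<n n<p p∣n = ℕ.<⇒≱ n<p (ℕD.∣⇒≤ {{ℕ.>-nonZero 0<n}} p∣n)

  p∤ℤ : ∀ {n} → 0 ℕ.< n → n ℕ.< p → ¬ (+ p Signed.∣ + n)
  p∤ℤ 0<n n<p p∣n = p∤ 0<n n<p (Signed.∣⇒∣ᵤ p∣n)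

  euclidsLemmaℤ : ∀ a b → + p Signed.∣ a * b → + p Signed.∣ a ⊎ + p Signed.∣ b
  euclidsLemmaℤ a b p∣ab
    with euclidsLemma ∣ a ∣ ∣ b ∣ p-prime (subst (p ℕD.∣_) (ℤ.abs-* a b) (Signed.∣⇒∣ᵤ p∣ab))
  ... | inj₁ p∣a = inj₁ (Signed.∣ᵤ⇒∣ p∣a)
  ... | inj₂ p∣b = inj₂ (Signed.∣ᵤ⇒∣ p∣b)

  p∣pC[k+1] : ∀ {k} → suc k ℕ.< p → + p Signed.∣ + (p C suc k)
  p∣pC[k+1] {k} k+1<p with euclidsLemma (suc k) (p C suc k) p-prime
      (subst (p ℕD.∣_) (sym ([k+1]*[n+1]C[k+1]≡[n+1]*nCk q k)) (ℕD.m∣m*n (q C k)))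
  ... | inj₁ p∣k+1 = ⊥-elim (p∤ (s≤s z≤n) k+1<p p∣k+1)
  ... | inj₂ p∣pCk = Signed.∣ᵤ⇒∣ p∣pCk

  binomialTransform-frobenius : ∀ s j → binomialTransform s j p ≈ j ^ p * s 0 + s p
  binomialTransform-frobenius s j = begin
      ∑ (suc q) t + t p
    ≡⟨ cong (_+ t p) (∑-head q t) ⟩
      (t 0 + ∑ q (t ∘ suc)) + t p
    ≈⟨ +-cong (+-cong (≈-refl {t 0}) (∑-cong-≈ q inner≈0)) (≈-refl {t p}) ⟩
      (t 0 + ∑ q (λ _ → + 0)) + t p
    ≡⟨ cong₂ (λ x y → (t 0 + x) + y) (∑-0 q) tp≡sp ⟩
      (t 0 + + 0) + s p
    ≡⟨ cong (_+ s p) (trans (ℤ.+-identityʳ (t 0)) (ℤ.*-identityˡ _)) ⟩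
      j ^ p * s 0 + s p
    ∎
    where
    open ≈-Reasoning
    t : ℕ → ℤ
    t k = + (p C k) * (j ^ (p ∸ k) * s k)
    inner≈0 : ∀ k → k ℕ.< q → t (suc k) ≈ + 0
    inner≈0 k k<q = ≈0⇒*≈0 (j ^ (p ∸ suc k) * s (suc k)) (∣⇒≈0 (p∣pC[k+1] (s≤s k<q)))
    tp≡sp : t p ≡ s p
    tp≡sp rewrite nCn≡1 p | ℕ.n∸n≡0 p = trans (ℤ.*-identityˡ _) (ℤ.*-identityˡ (s p))

  fermatℕ : ∀ x → (+ x) ^ p ≈ + x
  fermatℕ zero    = ≈-reflexive (ℤ.*-zeroˡ ((+ 0) ^ q))
  fermatℕ (suc x) = begin
      (+ suc x) ^ p
    ≡⟨ cong (_^ p) x+1 ⟩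
      (+ x + + 1) ^ p
    ≡⟨ sym (binomial-theorem (+ x) (+ 1) p) ⟩
      binomialTransform ((+ x) ^_) (+ 1) p
    ≈⟨ binomialTransform-frobenius ((+ x) ^_) (+ 1) ⟩
      (+ 1) ^ p * + 1 + (+ x) ^ p
    ≈⟨ +-cong (≈-reflexive (trans (ℤ.*-identityʳ _) (ℤ.^-zeroˡ p))) (fermatℕ x) ⟩
      + 1 + + x
    ≡⟨ trans (ℤ.+-comm (+ 1) (+ x)) (sym x+1) ⟩
      + suc x
    ∎
    where open ≈-Reasoning
          x+1 : + suc x ≡ + x + + 1
          x+1 = trans (cong +_ (ℕ.+-comm 1 x)) (ℤ.pos-+ x 1)

  fermat : ∀ u → u ^ p ≈ u
  fermat u = ≈-trans (^-congˡ p u≈r) (≈-trans (fermatℕ r) (≈-sym u≈r))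
    where
    r : ℕ
    r = u ℤDM.% + p
    u≈r : u ≈ + r
    u≈r = ∣⇒≈ (Signed.divides (u ℤDM./ + p) (trans (cong (_- + r) (ℤDM.a≡a%n+[a/n]*n u (+ p))) (cancel (+ r) _)))
      where cancel : ∀ a b → (a + b) - a ≡ b
            cancel = solve-∀

  qCk≈[-1]^[q-k] : ∀ i k → k ℕ.+ i ≡ q → + (q C k) ≈ (- + 1) ^ i
  qCk≈[-1]^[q-k] zero    k k+0≡q rewrite ℕ.+-identityʳ k | k+0≡q | nCn≡1 q = ≈-refl
  qCk≈[-1]^[q-k] (suc i) k k+1+i≡q = begin
      + (q C k)
    ≡⟨ add-sub (+ (q C k)) (+ (q C suc k)) ⟩
      (+ (q C k) + + (q C suc k)) - + (q C suc k)
    ≡⟨ cong (_- + (q C suc k)) (trans (sym (ℤ.pos-+ (q C k) (q C suc k))) (cong +_ (nCk+nC[k+1]≡[n+1]C[k+1] q k))) ⟩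
      + (p C suc k) - + (q C suc k)
    ≈⟨ +-cong (∣⇒≈0 (p∣pC[k+1] k+1<p)) (-‿cong (qCk≈[-1]^[q-k] i (suc k) (trans (sym (ℕ.+-suc k i)) k+1+i≡q))) ⟩
      + 0 - (- + 1) ^ i
    ≡⟨ negate ((- + 1) ^ i) ⟩
      (- + 1) ^ suc i
    ∎
    where open ≈-Reasoning
          k+1<p : suc k ℕ.< p
          k+1<p = s≤s (subst (suc k ℕ.≤_) k+1+i≡q (ℕ.m<m+n k (s≤s z≤n)))
          add-sub : ∀ a b → a ≡ (a + b) - b
          add-sub = solve-∀
          negate : ∀ x → + 0 - x ≡ (- + 1) * x
          negate = solve-∀

  2≤p : 2 ℕ.≤ p
  2≤p = ℕ.nonTrivial⇒n>1 p {{prime⇒nonTrivial p-prime}}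

  p∤fallingFactorial : ∀ {x k} → k ℕ.≤ x → x ℕ.< p → ¬ (+ p Signed.∣ fallingFactorial (+ x) k)
  p∤fallingFactorial {k = zero}  _   _   p∣1 = p∤ℤ (s≤s z≤n) 2≤p p∣1
  p∤fallingFactorial {x} {suc k} k<x x<p p∣ff with euclidsLemmaℤ (fallingFactorial (+ x) k) (+ x - + k) p∣ff
  ... | inj₁ p∣ff′ = p∤fallingFactorial (ℕ.<⇒≤ k<x) x<p p∣ff′
  ... | inj₂ p∣x-k = p∤ℤ (ℕ.m<n⇒0<n∸m k<x) (ℕ.≤-<-trans (ℕ.m∸n≤m x k) x<p)
                        (subst (+ p Signed.∣_) (trans (ℤ.m-n≡m⊖n x k) (ℤ.⊖-≥ (ℕ.<⇒≤ k<x))) p∣x-k)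

  -- x^p - x vanishes mod p at every x, and its falling-factorial coefficients are S(p, k) - S(1, k).
  ∑-stirling2-difference-fallingFactorial : ∀ {x} → x ℕ.< p →
    ∑ p (λ k → (+ stirling2 p k - + stirling2 1 k) * fallingFactorial (+ x) k) ≈ + 0
  ∑-stirling2-difference-fallingFactorial {x} x<p = begin
      ∑ p (λ k → (+ stirling2 p k - + stirling2 1 k) * ff k)
    ≡⟨ ∑-cong p (λ k → split (+ stirling2 p k) (+ stirling2 1 k) (ff k)) ⟩
      ∑ p (λ k → + stirling2 p k * ff k + (- + 1) * (+ stirling2 1 k * ff k))
    ≡⟨ trans (∑-distrib-+ p (λ k → + stirling2 p k * ff k) (λ k → (- + 1) * (+ stirling2 1 k * ff k)))
             (cong (λ y → ∑ p (λ k → + stirling2 p k * ff k) + y) (*-distribˡ-∑ p (- + 1) (λ k → + stirling2 1 k * ff k))) ⟩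
      ∑ p (λ k → + stirling2 p k * ff k) + (- + 1) * ∑ p (λ k → + stirling2 1 k * ff k)
    ≡⟨ cong₂ (λ a b → a + (- + 1) * b) ∑Sp≡x^p ∑S1≡x ⟩
      (+ x) ^ p + (- + 1) * (+ x * + 1)
    ≈⟨ +-cong (fermatℕ x) ≈-refl ⟩
      + x + (- + 1) * (+ x * + 1)
    ≡⟨ cancel (+ x) ⟩
      + 0
    ∎
    where
    open ≈-Reasoning
    ff : ℕ → ℤ
    ff = fallingFactorial (+ x)
    ∑Sp≡x^p : ∑ p (λ k → + stirling2 p k * ff k) ≡ (+ x) ^ p
    ∑Sp≡x^p = trans (sym (ℤ.+-identityʳ _))
      (trans (cong (λ y → ∑ p (λ k → + stirling2 p k * ff k) + y) (sym last≡0)) (∑-stirling2-fallingFactorial (+ x) p))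
      where last≡0 : + stirling2 p p * ff p ≡ + 0
            last≡0 = trans (cong (+ stirling2 p p *_) (fallingFactorial-above x<p)) (ℤ.*-zeroʳ (+ stirling2 p p))
    ∑S1≡x : ∑ p (λ k → + stirling2 1 k * ff k) ≡ + x * + 1
    ∑S1≡x = trans (∑-pad _ 2≤p (λ k 1<k → cong (λ s → + s * ff k) (stirling2-above 1<k))) (∑-stirling2-fallingFactorial (+ x) 1)
    split : ∀ s t f → (s - t) * f ≡ s * f + (- + 1) * (t * f)
    split = solve-∀
    cancel : ∀ x → x + (- + 1) * (x * + 1) ≡ + 0
    cancel = solve-∀

  -- Triangularity: (x)_k vanishes for k > x, and (x)_x = x! is a unit mod p.
  stirling2-p≈stirling2-1 : ∀ x → x ℕ.< p → + stirling2 p x ≈ + stirling2 1 x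
  stirling2-p≈stirling2-1 = <-rec _ step
    where
    a : ℕ → ℤ
    a k = + stirling2 p k - + stirling2 1 k
    step : ∀ x → (∀ {y} → y ℕ.< x → y ℕ.< p → + stirling2 p y ≈ + stirling2 1 y) → x ℕ.< p →
           + stirling2 p x ≈ + stirling2 1 x
    step x rec x<p = ∣⇒≈ (unit-factor (euclidsLemmaℤ (a x) (ff x) (≈0⇒∣ a[x]*[x]ₓ≈0)))
      where
      ff : ℕ → ℤ
      ff = fallingFactorial (+ x)
      others : ∀ k → k ℕ.< p → k ≢ x → a k * ff k ≈ + 0
      others k k<p k≢x with ℕ.<-cmp k x
      ... | tri< k<x _ _ = ≈0⇒*≈0 (ff k) (∣⇒≈0 (≈⇒∣ (rec k<x k<p)))
      ... | tri≈ _ k≡x _ = ⊥-elim (k≢x k≡x)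
      ... | tri> _ _ x<k = ≈-reflexive (trans (cong (a k *_) (fallingFactorial-above x<k)) (ℤ.*-zeroʳ (a k)))
      a[x]*[x]ₓ≈0 : a x * ff x ≈ + 0
      a[x]*[x]ₓ≈0 = ≈-trans (≈-sym (∑-single p (λ k → a k * ff k) x<p others)) (∑-stirling2-difference-fallingFactorial x<p)
      unit-factor : + p Signed.∣ a x ⊎ + p Signed.∣ ff x → + p Signed.∣ a x
      unit-factor (inj₁ p∣a[x]) = p∣a[x]
      unit-factor (inj₂ p∣[x]ₓ) = ⊥-elim (p∤fallingFactorial ℕ.≤-refl x<p p∣[x]ₓ)

  bell-p≈2 : + bell p ≈ + 2
  bell-p≈2 = begin
      + bell p
    ≡⟨ ∑ℕ-as-∑ (suc p) (stirling2 p) ⟩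
      ∑ p (λ k → + stirling2 p k) + + stirling2 p p
    ≈⟨ +-cong (∑-cong-≈ p (λ k k<p → stirling2-p≈stirling2-1 k k<p)) (≈-reflexive (cong +_ (stirling2-diagonal p))) ⟩
      ∑ p (λ k → + stirling2 1 k) + + 1
    ≡⟨ cong (_+ + 1) (bell≡∑stirling2 2≤p) ⟩
      + 2
    ∎
    where open ≈-Reasoning

  bellTransform-p : ∀ j → bellTransform 0 (+ j) p ≈ + j + + 2
  bellTransform-p j = begin
      bellTransform 0 (+ j) p
    ≈⟨ binomialTransform-frobenius (λ k → + bell k) (+ j) ⟩
      (+ j) ^ p * + 1 + + bell p
    ≈⟨ +-cong (*-cong (fermatℕ j) ≈-refl) bell-p≈2 ⟩
      + j * + 1 + + 2
    ≡⟨ cong (_+ + 2) (ℤ.*-identityʳ (+ j)) ⟩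
      + j + + 2
    ∎
    where open ≈-Reasoning

  bellTransform-q-suc : ∀ j → bellTransform 0 (+ suc j) q ≈ (+ j + + 2) - + j * bellTransform 0 (+ j) q
  bellTransform-q-suc j = begin
      bellTransform 0 (+ suc j) q
    ≡⟨ add-sub (bellTransform 0 (+ suc j) q) (+ j * t) ⟩
      (bellTransform 0 (+ suc j) q + + j * t) - + j * t
    ≡⟨ cong (λ b → (b + + j * t) - + j * t) (sym (bellTransform-1 j q)) ⟩
      (bellTransform 1 (+ j) q + + j * t) - + j * t
    ≡⟨ cong (_- + j * t) (sym (bellTransform-suc 0 (+ j) q)) ⟩
      bellTransform 0 (+ j) p - + j * t
    ≈⟨ +-cong (bellTransform-p j) ≈-refl ⟩
      (+ j + + 2) - + j * t
    ∎
    where open ≈-Reasoning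
          t : ℤ
          t = bellTransform 0 (+ j) q
          add-sub : ∀ a b → a ≡ (a + b) - b
          add-sub = solve-∀

  bellTransform-q≈derangement : ∀ j → bellTransform 0 (+ suc j) q - + 1 ≈ (- + 1) ^ j * + derangement j
  bellTransform-q≈derangement zero =
    ≈-trans (+-cong (bellTransform-q-suc 0) ≈-refl) (≈-reflexive (simplify (bellTransform 0 (+ 0) q)))
    where simplify : ∀ x → ((+ 0 + + 2) - + 0 * x) - + 1 ≡ + 1 * + 1
          simplify = solve-∀
  bellTransform-q≈derangement (suc j) = begin
      t (suc j) - + 1
    ≈⟨ +-cong (bellTransform-q-suc (suc j)) ≈-refl ⟩
      ((+ suc j + + 2) - + suc j * t j) - + 1
    ≡⟨ rearrange (+ suc j) (t j) ⟩
      + 1 - + suc j * (t j - + 1)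
    ≈⟨ +-cong (≈-refl {+ 1}) (-‿cong (*-cong (≈-refl {+ suc j}) (bellTransform-q≈derangement j))) ⟩
      + 1 - + suc j * (σ * + derangement j)
    ≡⟨ cong (λ one → one - + suc j * (σ * + derangement j)) (sym ([-1]^n*[-1]^n≡1 j)) ⟩
      σ * σ - + suc j * (σ * + derangement j)
    ≡⟨ factor σ (+ suc j) (+ derangement j) ⟩
      (- + 1) ^ suc j * (+ suc j * + derangement j + (- + 1) ^ suc j)
    ≡⟨ cong ((- + 1) ^ suc j *_) (sym (derangement-suc j)) ⟩
      (- + 1) ^ suc j * + derangement (suc j)
    ∎
    where open ≈-Reasoning
          t : ℕ → ℤ
          t j = bellTransform 0 (+ suc j) q
          σ : ℤ
          σ = (- + 1) ^ j
          rearrange : ∀ n x → ((n + + 2) - n * x) - + 1 ≡ + 1 - n * (x - + 1)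
          rearrange = solve-∀
          factor : ∀ s n D → s * s - n * (s * D) ≡ ((- + 1) * s) * (n * D + (- + 1) * s)
          factor = solve-∀

  module _ (m : ℕ) (u : ℤ) (u*-m≈1 : u * - + m ≈ + 1) where

    u^q≈1 : u ^ q ≈ + 1
    u^q≈1 = begin
        u ^ q
      ≡⟨ sym (ℤ.*-identityʳ (u ^ q)) ⟩
        u ^ q * + 1
      ≈⟨ *-cong (≈-refl {u ^ q}) u*-m≈1 ⟨
        u ^ q * (u * - + m)
      ≡⟨ sym (ℤ.*-assoc (u ^ q) u (- + m)) ⟩
        u ^ q * u * - + m
      ≡⟨ cong (_* - + m) (ℤ.*-comm (u ^ q) u) ⟩
        u ^ p * - + m
      ≈⟨ *-cong (fermat u) ≈-refl ⟩
        u * - + m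
      ≈⟨ u*-m≈1 ⟩
        + 1
      ∎
      where open ≈-Reasoning

    qCk*m^[q-k]≈u^k : ∀ {k} → k ℕ.≤ q → + (q C k) * (+ m) ^ (q ∸ k) ≈ u ^ k
    qCk*m^[q-k]≈u^k {k} k≤q = begin
        + (q C k) * (+ m) ^ i
      ≈⟨ *-cong (qCk≈[-1]^[q-k] i k (ℕ.m+[n∸m]≡n k≤q)) ≈-refl ⟩
        (- + 1) ^ i * (+ m) ^ i
      ≡⟨ trans (sym (^-distribʳ-* (- + 1) (+ m) i)) (cong (_^ i) (ℤ.-1*i≡-i (+ m))) ⟩
        (- + m) ^ i
      ≈⟨ ≈-trans (*-cong u^q≈1 ≈-refl) (≈-reflexive (ℤ.*-identityˡ ((- + m) ^ i))) ⟨
        u ^ q * (- + m) ^ i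
      ≡⟨ cong (λ e → u ^ e * (- + m) ^ i) (sym (ℕ.m+[n∸m]≡n k≤q)) ⟩
        u ^ (k ℕ.+ i) * (- + m) ^ i
      ≡⟨ trans (cong (_* (- + m) ^ i) (ℤ.^-distribˡ-+-* u k i)) (ℤ.*-assoc (u ^ k) (u ^ i) _) ⟩
        u ^ k * (u ^ i * (- + m) ^ i)
      ≡⟨ cong (u ^ k *_) (sym (^-distribʳ-* u (- + m) i)) ⟩
        u ^ k * (u * - + m) ^ i
      ≈⟨ *-cong (≈-refl {u ^ k}) (^-congˡ i u*-m≈1) ⟩
        u ^ k * (+ 1) ^ i
      ≡⟨ trans (cong (u ^ k *_) (ℤ.^-zeroˡ i)) (ℤ.*-identityʳ (u ^ k)) ⟩
        u ^ k
      ∎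
      where open ≈-Reasoning
            i = q ∸ k

    bellTransform-q≈∑bell*u^k : ∀ a →
      bellTransform a (+ m) q ≈ + bell a + ∑ q (λ j → + bell (a ℕ.+ suc j) * u ^ suc j)
    bellTransform-q≈∑bell*u^k a = begin
        bellTransform a (+ m) q
      ≈⟨ ∑-cong-≈ (suc q) (λ k k<p → ≈-trans (≈-reflexive (sym (ℤ.*-assoc (+ (q C k)) _ _)))
           (≈-trans (*-cong (qCk*m^[q-k]≈u^k (ℕ.≤-pred k<p)) ≈-refl) (≈-reflexive (ℤ.*-comm (u ^ k) _)))) ⟩
        ∑ (suc q) (λ k → + bell (a ℕ.+ k) * u ^ k)
      ≡⟨ ∑-head q _ ⟩
        + bell (a ℕ.+ 0) * + 1 + ∑ q (λ j → + bell (a ℕ.+ suc j) * u ^ suc j)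
      ≡⟨ cong (_+ ∑ q (λ j → + bell (a ℕ.+ suc j) * u ^ suc j))
              (trans (ℤ.*-identityʳ _) (cong (λ i → + bell i) (ℕ.+-identityʳ a))) ⟩
        + bell a + ∑ q (λ j → + bell (a ℕ.+ suc j) * u ^ suc j)
      ∎
      where open ≈-Reasoning

    ∑bell[k+1]u^k≈[-1]^m*Dₘ : ∑ q (λ j → + bell (suc (suc j)) * u ^ suc j) ≈ (- + 1) ^ m * + derangement m
    ∑bell[k+1]u^k≈[-1]^m*Dₘ = begin
        ∑ q (λ j → + bell (suc (suc j)) * u ^ suc j)
      ≈⟨ x≈b+s⇒s≈x-b (bellTransform-q≈∑bell*u^k 1) ⟩
        bellTransform 1 (+ m) q - + 1
      ≡⟨ cong (_- + 1) (bellTransform-1 m q) ⟩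
        bellTransform 0 (+ suc m) q - + 1
      ≈⟨ bellTransform-q≈derangement m ⟩
        (- + 1) ^ m * + derangement m
      ∎
      where open ≈-Reasoning

    ∑bell[k+2]u^k≈[-1]^m*[Dₘ-Dₘ₊₁] :
      ∑ q (λ j → + bell (suc (suc (suc j))) * u ^ suc j) ≈ (- + 1) ^ m * (+ derangement m - + derangement (suc m))
    ∑bell[k+2]u^k≈[-1]^m*[Dₘ-Dₘ₊₁] = begin
        ∑ q (λ j → + bell (suc (suc (suc j))) * u ^ suc j)
      ≈⟨ x≈b+s⇒s≈x-b (bellTransform-q≈∑bell*u^k 2) ⟩
        bellTransform 2 (+ m) q - + 2
      ≡⟨ cong (_- + 2) (bellTransform-2 m q) ⟩
        (t (suc m) + t m) - + 2
      ≈⟨ +-cong (+-cong (bellTransform-q-suc (suc m)) ≈-refl) ≈-refl ⟩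
        (((+ suc m + + 2) - + suc m * t m) + t m) - + 2
      ≡⟨ cong (λ n → (((n + + 2) - n * t m) + t m) - + 2) (sym (+j+1≡+[1+j] m)) ⟩
        (((+ m + + 1 + + 2) - (+ m + + 1) * t m) + t m) - + 2
      ≡⟨ rearrange (+ m) (t m) ⟩
        + 1 - + m * (t m - + 1)
      ≈⟨ +-cong (≈-refl {+ 1}) (-‿cong (*-cong (≈-refl {+ m}) (bellTransform-q≈derangement m))) ⟩
        + 1 - + m * (σ * + derangement m)
      ≡⟨ cong (λ one → one - + m * (σ * + derangement m)) (sym ([-1]^n*[-1]^n≡1 m)) ⟩
        σ * σ - + m * (σ * + derangement m)
      ≡⟨ factor σ (+ m) (+ derangement m) ⟩
        σ * (+ derangement m - ((+ m + + 1) * + derangement m + (- + 1) * σ))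
      ≡⟨ cong (λ n → σ * (+ derangement m - (n * + derangement m + (- + 1) ^ suc m))) (+j+1≡+[1+j] m) ⟩
        σ * (+ derangement m - (+ suc m * + derangement m + (- + 1) ^ suc m))
      ≡⟨ cong (λ D → σ * (+ derangement m - D)) (sym (derangement-suc m)) ⟩
        σ * (+ derangement m - + derangement (suc m))
      ∎
      where open ≈-Reasoning
            t : ℕ → ℤ
            t j = bellTransform 0 (+ suc j) q
            σ : ℤ
            σ = (- + 1) ^ m
            rearrange : ∀ n x → (((n + + 1 + + 2) - (n + + 1) * x) + x) - + 2 ≡ + 1 - n * (x - + 1)
            rearrange = solve-∀
            factor : ∀ s n D → s * s - n * (s * D) ≡ s * (D - ((n + + 1) * D + (- + 1) * s))
            factor = solve-∀

corollary3p1 : (m p : ℕ) → m ≥ 1 → Prime p → ¬ (+ p ∣ + m) →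
    (u : ℤ) → + p ∣ (u * (- (+ m)) - + 1) →
      (+ p ∣ (∑ (p ∸ 1) (λ j → + bell (suc (suc j)) * u ^ suc j)
               - (- + 1) ^ m * + derangement m))
      × (+ p ∣ (∑ (p ∸ 1) (λ j → + bell (suc (suc (suc j))) * u ^ suc j)
               - (- + 1) ^ m * (+ derangement m - + derangement (suc m))))
corollary3p1 m zero    _ p-prime _ _ _ with ℕ.nonTrivial⇒n>1 0 {{prime⇒nonTrivial p-prime}}
... | ()
-- m ≥ 1 and p ∤ m are implied by the existence of u.
corollary3p1 m (suc q) _ p-prime _ u p∣u*-m-1 =
    Signed.∣⇒∣ᵤ (≈⇒∣ (∑bell[k+1]u^k≈[-1]^m*Dₘ m u u*-m≈1))
  , Signed.∣⇒∣ᵤ (≈⇒∣ (∑bell[k+2]u^k≈[-1]^m*[Dₘ-Dₘ₊₁] m u u*-m≈1))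
  where
  open AtPrime p-prime
  u*-m≈1 : u * - + m ≈ + 1
  u*-m≈1 = ∣⇒≈ (Signed.∣ᵤ⇒∣ p∣u*-m-1)
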